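{- A graph $G$ satisfies $F(G)=2$ if and only if $G$ is isomorphic to one of the following $15$ graphs: $3K_1$; $K_2+K_1$; $K_2+K_2$; the star $K_{1,3}$; the cycle $C_4$; the paw (a triangle with one pendant edge attached to one of its vertices); the diamond $K_4-e$ ($K_4$ with one edge removed); $K_4$; the path $P_5$; the cycle $C_5$; the bull (a triangle with a pendant edge attached at each of two distinct vertices of the triangle); the house (the cycle $C_5$ with one chord added); the gem (a vertex adjacent to all four vertices of a path $P_4$); the path $P_6$; and the net (the corona of $K_3$: a triangle with one pendant edge attached at each of its three vertices).
   Context: All graphs are finite and simple. $K_n$, $P_n$, $C_n$ denote the complete graph, path, and cycle on $n$ vertices; $K_{r,t}$ is the complete bipartite graph; $G+H$ is the disjoint union, and $3K_1$ is three isolated vertices. Given a graph $G$ and a set $S\subseteq V(G)$, the forcing rule is: if a vertex $v\in S$ has exactly one neighbor $u$ not in $S$, then $u$ is added to $S$. A set $S$ is a failed zero-forcing set of $G$ if repeated application of the forcing rule starting from $S$ does not result in all vertices of $G$ being in $S$. The failed zero-forcing number $F(G)$ is the maximum cardinality of a failed zero-forcing set of $G$ (the empty set counts, with cardinality $0$). -}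

module Defs where

open import Data.Nat using (ℕ; _≤_)
open import Data.Fin using (Fin; #_; _≟_)
open import Data.Fin.Subset using (Subset; _∈_; _∉_; ∣_∣)
open import Data.Bool using (Bool; true; false; _∧_; _∨_; not; T)
open import Data.List using (List; []; _∷_)
open import Data.Sum using (_⊎_)
open import Data.Product using (Σ; ∃; _×_; _,_)
open import Relation.Nullary using (¬_; ⌊_⌋)
open import Relation.Binary.PropositionalEquality using (_≡_; _≢_)
open import Function.Bundles using (_↔_; Inverse)

record Graph (n : ℕ) : Set where
  field
    Adj    : Fin n → Fin n → Bool
    sym    : ∀ u v → Adj u v ≡ Adj v u
    irrefl : ∀ v → Adj v v ≡ false
open Graph public

Adjacent : ∀ {n} → Graph n → Fin n → Fin n → Set
Adjacent G u v = T (Adj G u v)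

-- The set obtained by repeatedly applying the
-- forcing rule from S is the least set containing S and closed under
-- the rule "if u is in the set and v is the only neighbour of u outside
-- the set, add v".

data Closure {n} (G : Graph n) (S : Subset n) : Fin n → Set where
  init  : ∀ {v} → v ∈ S → Closure G S v
  force : ∀ {u v} → Closure G S u → Adjacent G u v
        → (∀ w → Adjacent G u w → w ≢ v → Closure G S w)
        → Closure G S v

FailedZF : ∀ {n} → Graph n → Subset n → Set
FailedZF G S = ∃ λ v → ¬ Closure G S v

IsFailedZFNumber : ∀ {n} → Graph n → ℕ → Set
IsFailedZFNumber {n} G k =
  (Σ (Subset n) λ S → FailedZF G S × ∣ S ∣ ≡ k)
  × (∀ (S : Subset n) → FailedZF G S → ∣ S ∣ ≤ k)

record _≅_ {n m} (G : Graph n) (H : Graph m) : Set where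
  field
    bij      : Fin n ↔ Fin m
    adj-pres : ∀ u v → Adj G u v ≡ Adj H (Inverse.to bij u) (Inverse.to bij v)

private
  _==_ : ∀ {n} → Fin n → Fin n → Bool
  a == b = ⌊ a ≟ b ⌋

  hasEdge : ∀ {n} → List (Fin n × Fin n) → Fin n → Fin n → Bool
  hasEdge [] u v = false
  hasEdge ((a , b) ∷ es) u v = ((a == u ∧ b == v) ∨ (a == v ∧ b == u)) ∨ hasEdge es u v

  ∧-false : ∀ b → b ∧ false ≡ false
  ∧-false true = _≡_.refl
  ∧-false false = _≡_.refl

open import Relation.Binary.PropositionalEquality using (refl; cong; cong₂)
open import Data.Bool.Properties using (∨-comm)

mkGraph : (n : ℕ) → List (Fin n × Fin n) → Graph n
mkGraph n es = record
  { Adj = λ u v → not (u == v) ∧ hasEdge es u v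
  ; sym = λ u v → cong₂ _∧_ (cong not (eqsym u v)) (hsym es u v)
  ; irrefl = λ v → irr v
  }
  where
  eqsym : ∀ (u v : Fin n) → (u == v) ≡ (v == u)
  eqsym u v with u ≟ v | v ≟ u
  ... | Relation.Nullary.yes _ | Relation.Nullary.yes _ = refl
  ... | Relation.Nullary.no _  | Relation.Nullary.no _  = refl
  ... | Relation.Nullary.yes p | Relation.Nullary.no q  = Data.Empty.⊥-elim (q (Relation.Binary.PropositionalEquality.sym p))
    where import Data.Empty
  ... | Relation.Nullary.no p  | Relation.Nullary.yes q = Data.Empty.⊥-elim (p (Relation.Binary.PropositionalEquality.sym q))
    where import Data.Empty
  hsym : ∀ es' (u v : Fin n) → hasEdge es' u v ≡ hasEdge es' v u
  hsym [] u v = refl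
  hsym ((a , b) ∷ es') u v =
    cong₂ _∨_ (∨-comm (a == u ∧ b == v) (a == v ∧ b == u)) (hsym es' u v)
  irr : ∀ (v : Fin n) → not (v == v) ∧ hasEdge es v v ≡ false
  irr v with v ≟ v
  ... | Relation.Nullary.yes _ = refl
  ... | Relation.Nullary.no ¬p = Data.Empty.⊥-elim (¬p refl)
    where import Data.Empty

3K₁ : Graph 3
3K₁ = mkGraph 3 []

K₂+K₁ : Graph 3
K₂+K₁ = mkGraph 3 ((# 0 , # 1) ∷ [])

K₂+K₂ : Graph 4
K₂+K₂ = mkGraph 4 ((# 0 , # 1) ∷ (# 2 , # 3) ∷ [])

K₁,₃ : Graph 4
K₁,₃ = mkGraph 4 ((# 0 , # 1) ∷ (# 0 , # 2) ∷ (# 0 , # 3) ∷ [])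

C₄ : Graph 4
C₄ = mkGraph 4 ((# 0 , # 1) ∷ (# 1 , # 2) ∷ (# 2 , # 3) ∷ (# 3 , # 0) ∷ [])

paw : Graph 4
paw = mkGraph 4 ((# 0 , # 1) ∷ (# 1 , # 2) ∷ (# 2 , # 0) ∷ (# 2 , # 3) ∷ [])

diamond : Graph 4
diamond = mkGraph 4 ((# 0 , # 1) ∷ (# 0 , # 2) ∷ (# 0 , # 3) ∷ (# 1 , # 2) ∷ (# 1 , # 3) ∷ [])

K₄ : Graph 4
K₄ = mkGraph 4 ((# 0 , # 1) ∷ (# 0 , # 2) ∷ (# 0 , # 3) ∷ (# 1 , # 2) ∷ (# 1 , # 3) ∷ (# 2 , # 3) ∷ [])

P₅ : Graph 5
P₅ = mkGraph 5 ((# 0 , # 1) ∷ (# 1 , # 2) ∷ (# 2 , # 3) ∷ (# 3 , # 4) ∷ [])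

C₅ : Graph 5
C₅ = mkGraph 5 ((# 0 , # 1) ∷ (# 1 , # 2) ∷ (# 2 , # 3) ∷ (# 3 , # 4) ∷ (# 4 , # 0) ∷ [])

bull : Graph 5
bull = mkGraph 5 ((# 0 , # 1) ∷ (# 1 , # 2) ∷ (# 2 , # 0) ∷ (# 0 , # 3) ∷ (# 1 , # 4) ∷ [])

house : Graph 5
house = mkGraph 5 ((# 0 , # 1) ∷ (# 1 , # 2) ∷ (# 2 , # 3) ∷ (# 3 , # 4) ∷ (# 4 , # 0) ∷ (# 0 , # 2) ∷ [])

gem : Graph 5
gem = mkGraph 5 ((# 0 , # 1) ∷ (# 1 , # 2) ∷ (# 2 , # 3) ∷ (# 4 , # 0) ∷ (# 4 , # 1) ∷ (# 4 , # 2) ∷ (# 4 , # 3) ∷ [])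

P₆ : Graph 6
P₆ = mkGraph 6 ((# 0 , # 1) ∷ (# 1 , # 2) ∷ (# 2 , # 3) ∷ (# 3 , # 4) ∷ (# 4 , # 5) ∷ [])

net : Graph 6
net = mkGraph 6 ((# 0 , # 1) ∷ (# 1 , # 2) ∷ (# 2 , # 0) ∷ (# 0 , # 3) ∷ (# 1 , # 4) ∷ (# 2 , # 5) ∷ [])

IsOneOfFifteen : ∀ {n} → Graph n → Set
IsOneOfFifteen G =
  G ≅ 3K₁ ⊎ G ≅ K₂+K₁ ⊎ G ≅ K₂+K₂ ⊎ G ≅ K₁,₃ ⊎ G ≅ C₄ ⊎ G ≅ paw ⊎ G ≅ diamond
  ⊎ G ≅ K₄ ⊎ G ≅ P₅ ⊎ G ≅ C₅ ⊎ G ≅ bull ⊎ G ≅ house ⊎ G ≅ gem ⊎ G ≅ P₆ ⊎ G ≅ net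

-- A set S is stalled when no vertex of S has exactly one neighbour outside S. Forcing
-- from a subset of a stalled set never leaves it, so a proper stalled set is a failed
-- zero-forcing set. Every graph on at least seven vertices has a proper stalled set of
-- size three: induct over induced subgraphs G[U], deleting an isolated vertex, or a leaf
-- together with its neighbour; when the minimum degree is at least two, three vertices
-- with few edges among them do. Hence F(G) = 2 forces |V(G)| ≤ 6, and those graphs are
-- classified by exhaustive computation over all graphs built vertex by vertex, F being
-- invariant under isomorphism.
module Submission where

open import Defs hiding (sym)
open import Data.Nat using (ℕ; zero; suc; _+_; _≤_; _<_; _≤?_; _≤ᵇ_; _≡ᵇ_; z≤n; s≤s)
open import Data.Nat.Properties
  using ( +-suc; +-comm; +-identityʳ; +-cancelˡ-≡; +-cancelˡ-≤; +-cancelʳ-≤; +-monoʳ-≤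
        ; ≤-refl; ≤-trans; ≤-reflexive; ≤-pred; m≤n⇒m≤1+n; n≤1+n; m≤m+n; 1+n≰n; ≤∧≢⇒<; ≰⇒>
        ; 0≢1+n; ≡ᵇ⇒≡; ≤⇒≤ᵇ; ≤ᵇ⇒≤; +-0-commutativeMonoid; module ≤-Reasoning )
  renaming (_≟_ to _≟ℕ_)
open import Data.Bool as Bool using (Bool; true; false; _∧_; _∨_; not; T; if_then_else_)
open import Data.Bool.Properties
  using (¬-not; not-injective; ∧-assoc; ∧-comm; ∧-zeroʳ; ∧-identityʳ; T-≡)
import Data.Bool.ListAction as ListAction
open import Data.Empty using (⊥-elim)
open import Data.Fin using (Fin; zero; suc)
open import Data.Fin.Properties using (_≟_; any?; all?)
open import Data.Fin.Subset using (Subset; ∣_∣; _∈_)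
open import Data.List using (List; []; _∷_; length; foldr; allFin)
open import Data.List.Membership.Propositional using () renaming (_∈_ to _∈ˡ_)
open import Data.List.Relation.Unary.All as All using (All; []; _∷_)
open import Data.List.Relation.Unary.AllPairs using ([]; _∷_)
open import Data.List.Relation.Unary.Any using (here; there)
open import Data.List.Relation.Unary.Unique.Propositional using (Unique)
open import Data.Maybe as Maybe using (Maybe; just; nothing; fromMaybe; _<∣>_; _>>=_; is-just)
open import Data.Product using (Σ; ∃; _×_; _,_; proj₁; proj₂)
open import Data.Sum using (_⊎_; inj₁; inj₂)
open import Data.Vec using ([]; _∷_; lookup; tabulate)
open import Data.Vec.Properties using ([]=⇒lookup; lookup⇒[]=; lookup∘tabulate; tabulate∘lookup)
import Algebra.Properties.CommutativeMonoid.Sum as MonoidSum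
open import Function using (_∘_)
open import Function.Bundles using (_⇔_; mk⇔; Equivalence; Inverse; _↔_; mk↔ₛ′)
open import Function.Construct.Composition using (_↔-∘_)
open import Function.Construct.Identity using (↔-id)
open import Function.Construct.Symmetry using (↔-sym)
open import Relation.Nullary using (¬_; yes; no; does)
open import Relation.Nullary.Decidable using (_×-dec_)
open import Relation.Binary.PropositionalEquality
  using (_≡_; _≢_; refl; sym; trans; cong; cong₂; subst; module ≡-Reasoning)

Pred : ℕ → Set
Pred n = Fin n → Bool

infix 4 _==_
_==_ : ∀ {n} → Fin n → Fin n → Bool
a == b = does (a ≟ b)

==-refl : ∀ {n} (a : Fin n) → (a == a) ≡ true
==-refl a with a ≟ a
... | yes _ = refl
... | no a≢a = ⊥-elim (a≢a refl)

==-false : ∀ {n} {a b : Fin n} → a ≢ b → (a == b) ≡ false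
==-false {a = a} {b} a≢b with a ≟ b
... | yes a≡b = ⊥-elim (a≢b a≡b)
... | no _ = refl

∧-true⁻ : ∀ {a b} → (a ∧ b) ≡ true → a ≡ true × b ≡ true
∧-true⁻ {true} b≡true = refl , b≡true

∧-true⁺ : ∀ {a b} → a ≡ true → b ≡ true → (a ∧ b) ≡ true
∧-true⁺ refl b≡true = b≡true

∨-true⁻ : ∀ {a b} → (a ∨ b) ≡ true → a ≡ true ⊎ b ≡ true
∨-true⁻ {true} _ = inj₁ refl
∨-true⁻ {false} b≡true = inj₂ b≡true

∨-introˡ : ∀ {a b} → a ≡ true → (a ∨ b) ≡ true
∨-introˡ refl = refl

∨-introʳ : ∀ {a b} → b ≡ true → (a ∨ b) ≡ true
∨-introʳ {true} _ = refl
∨-introʳ {false} b≡true = b≡true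

T⇒≡true : ∀ {b} → T b → b ≡ true
T⇒≡true = Equivalence.to T-≡

≡true⇒T : ∀ {b} → b ≡ true → T b
≡true⇒T = Equivalence.from T-≡

boolToℕ : Bool → ℕ
boolToℕ true = 1
boolToℕ false = 0

count : ∀ {n} → Pred n → ℕ
count {zero} P = 0
count {suc n} P = boolToℕ (P zero) + count (λ i → P (suc i))


count-cong : ∀ {n} {P Q : Pred n} → (∀ i → P i ≡ Q i) → count P ≡ count Q
count-cong {zero} e = refl
count-cong {suc n} e = cong₂ _+_ (cong boolToℕ (e zero)) (count-cong (λ i → e (suc i)))

count-none : ∀ {n} {P : Pred n} → (∀ i → P i ≡ false) → count P ≡ 0
count-none {zero} e = refl
count-none {suc n} {P} e rewrite e zero = count-none (λ i → e (suc i))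

count≡0⇒none : ∀ {n} (P : Pred n) → count P ≡ 0 → ∀ i → P i ≡ false
count≡0⇒none {suc n} P c i with P zero in e
count≡0⇒none {suc n} P () i | true
count≡0⇒none {suc n} P c zero | false = e
count≡0⇒none {suc n} P c (suc i) | false = count≡0⇒none (λ j → P (suc j)) c i

count>0⇒witness : ∀ {n} (P : Pred n) → 1 ≤ count P → ∃ λ i → P i ≡ true
count>0⇒witness P c with any? (λ i → P i Bool.≟ true)
... | yes w = w
... | no none with () ← subst (1 ≤_) (count-none (λ i → ¬-not (λ Pi → none (i , Pi)))) c

count-mono : ∀ {n} (P Q : Pred n) → (∀ i → P i ≡ true → Q i ≡ true) → count P ≤ count Q
count-mono {zero} P Q P⊆Q = z≤n
count-mono {suc n} P Q P⊆Q with P zero in e | Q zero in e'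
... | true  | true  = s≤s (count-mono _ _ λ i → P⊆Q (suc i))
... | false | true  = m≤n⇒m≤1+n (count-mono _ _ λ i → P⊆Q (suc i))
... | false | false = count-mono _ _ λ i → P⊆Q (suc i)
... | true  | false with () ← trans (sym e') (P⊆Q zero e)

count-partition : ∀ {n} (P Q : Pred n) →
                  count P ≡ count (λ i → P i ∧ Q i) + count (λ i → P i ∧ not (Q i))
count-partition {zero} P Q = refl
count-partition {suc n} P Q with P zero | Q zero
... | false | _     = count-partition (λ i → P (suc i)) (λ i → Q (suc i))
... | true  | true  = cong suc (count-partition (λ i → P (suc i)) (λ i → Q (suc i)))
... | true  | false = trans (cong suc (count-partition (λ i → P (suc i)) (λ i → Q (suc i))))
                           (sym (+-suc _ _))

count-at : ∀ {n} (P : Pred n) (a : Fin n) → count (λ y → P y ∧ (y == a)) ≡ boolToℕ (P a)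
count-at {suc n} P zero
  rewrite ∧-identityʳ (P zero) | count-none {P = λ i → P (suc i) ∧ false} (λ i → ∧-zeroʳ (P (suc i)))
  = +-identityʳ _
count-at {suc n} P (suc a) rewrite ∧-zeroʳ (P zero) = count-at (λ i → P (suc i)) a

count-remove : ∀ {n} (P : Pred n) (a : Fin n) →
               count P ≡ boolToℕ (P a) + count (λ y → P y ∧ not (y == a))
count-remove P a =
  trans (count-partition P (_== a)) (cong (_+ count (λ y → P y ∧ not (y == a))) (count-at P a))

count≡1⇒unique : ∀ {n} (P : Pred n) → count P ≡ 1 →
                 ∃ λ p → P p ≡ true × (∀ y → P y ≡ true → y ≡ p)
count≡1⇒unique P c with count>0⇒witness P (subst (1 ≤_) (sym c) (s≤s z≤n))
... | p , Pp = p , Pp , unique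
  where
  rest : ℕ
  rest = count (λ y → P y ∧ not (y == p))
  rest≡0 : rest ≡ 0
  rest≡0 = +-cancelˡ-≡ 1 rest 0 (begin
    1 + rest                  ≡⟨ cong (λ b → boolToℕ b + rest) Pp ⟨
    boolToℕ (P p) + rest      ≡⟨ count-remove P p ⟨
    count P                   ≡⟨ c ⟩
    1                         ∎)
    where open ≡-Reasoning
  unique : ∀ y → P y ≡ true → y ≡ p
  unique y Py with y ≟ p | count≡0⇒none _ rest≡0 y
  ... | yes y≡p | _ = y≡p
  ... | no _ | rest-y with () ← trans (cong (_∧ true) (sym Py)) rest-y

member : ∀ {n} → List (Fin n) → Pred n
member [] y = false
member (a ∷ l) y = (y == a) ∨ member l y

tally : ∀ {n} → Pred n → List (Fin n) → ℕ
tally P [] = 0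
tally P (a ∷ l) = boolToℕ (P a) + tally P l

All-member : ∀ {n} {P : Fin n → Set} {l x} → All P l → member l x ≡ true → P x
All-member {x = x} (_∷_ {a} Pa Pl) m with x ≟ a
... | yes refl = Pa
... | no _ = All-member Pl m

member⇒∈ : ∀ {n} {x : Fin n} l → member l x ≡ true → x ∈ˡ l
member⇒∈ {x = x} (a ∷ l) m with x ≟ a
... | yes x≡a = here x≡a
... | no _ = there (member⇒∈ l m)

member-All : ∀ {n} {P : Fin n → Set} l → (∀ x → member l x ≡ true → P x) → All P l
member-All [] f = []
member-All (a ∷ l) f = f a (∨-introˡ (==-refl a)) ∷ member-All l (λ x m → f x (∨-introʳ m))

All≢⇒member-false : ∀ {n} {a : Fin n} {l} → All (a ≢_) l → member l a ≡ false
All≢⇒member-false [] = refl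
All≢⇒member-false (a≢b ∷ rest) rewrite ==-false a≢b = All≢⇒member-false rest

member-false⇒All≢ : ∀ {n} {a : Fin n} l → member l a ≡ false → All (a ≢_) l
member-false⇒All≢ [] _ = []
member-false⇒All≢ {a = a} (b ∷ l) m with a ≟ b
... | no a≢b = a≢b ∷ member-false⇒All≢ l m

count-member : ∀ {n} (P : Pred n) {l} → Unique l → count (λ y → P y ∧ member l y) ≡ tally P l
count-member P [] = count-none (λ y → ∧-zeroʳ (P y))
count-member P {a ∷ l} (a∉l ∷ l-unique) = begin
  count (λ y → P y ∧ member (a ∷ l) y)
    ≡⟨ count-remove _ a ⟩
  boolToℕ (P a ∧ ((a == a) ∨ member l a)) + count (λ y → (P y ∧ member (a ∷ l) y) ∧ not (y == a))
    ≡⟨ cong₂ _+_ (cong (λ b → boolToℕ (P a ∧ (b ∨ member l a))) (==-refl a)) (count-cong drop-a) ⟩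
  boolToℕ (P a ∧ true) + count (λ y → P y ∧ member l y)
    ≡⟨ cong (λ b → boolToℕ b + count (λ y → P y ∧ member l y)) (∧-identityʳ (P a)) ⟩
  boolToℕ (P a) + count (λ y → P y ∧ member l y)
    ≡⟨ cong (boolToℕ (P a) +_) (count-member P l-unique) ⟩
  tally P (a ∷ l) ∎
  where
  open ≡-Reasoning
  drop-a : ∀ y → ((P y ∧ ((y == a) ∨ member l y)) ∧ not (y == a)) ≡ (P y ∧ member l y)
  drop-a y with y ≟ a
  ... | yes refl rewrite All≢⇒member-false a∉l = trans (∧-zeroʳ _) (sym (∧-zeroʳ (P y)))
  ... | no _ = ∧-identityʳ _

tally≤length : ∀ {n} (P : Pred n) l → tally P l ≤ length l
tally≤length P [] = z≤n
tally≤length P (a ∷ l) with P a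
... | true = s≤s (tally≤length P l)
... | false = m≤n⇒m≤1+n (tally≤length P l)

tally-all : ∀ {n} {P : Pred n} {l} → All (λ a → P a ≡ true) l → tally P l ≡ length l
tally-all [] = refl
tally-all (Pa ∷ Pl) rewrite Pa = cong suc (tally-all Pl)

tally<length : ∀ {n} (P : Pred n) {a} l → member l a ≡ true → P a ≡ false → tally P l < length l
tally<length P {a} (b ∷ l) m Pa with a ≟ b
... | yes refl rewrite Pa = s≤s (tally≤length P l)
... | no _ with P b
...   | true  = s≤s (tally<length P l m Pa)
...   | false = m≤n⇒m≤1+n (tally<length P l m Pa)

count-list : ∀ {n} {l : List (Fin n)} → Unique l → count (member l) ≡ length l
count-list {l = l} l-unique =
  trans (count-member (λ _ → true) l-unique) (tally-all (All.tabulate {xs = l} (λ _ → refl)))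

count-without : ∀ {n} (U : Pred n) {l} → Unique l → All (λ a → U a ≡ true) l →
                count U ≡ length l + count (λ y → U y ∧ not (member l y))
count-without U {l} l-unique l⊆U = begin
  count U                                  ≡⟨ count-partition U (member l) ⟩
  count (λ y → U y ∧ member l y) + rest    ≡⟨ cong (_+ rest) (count-member U l-unique) ⟩
  tally U l + rest                         ≡⟨ cong (_+ rest) (tally-all l⊆U) ⟩
  length l + rest                          ∎
  where
  open ≡-Reasoning
  rest = count (λ y → U y ∧ not (member l y))

outside-list : ∀ {n} (U : Pred n) {l} → Unique l → All (λ a → U a ≡ true) l → length l < count U →
               ∃ λ u → U u ≡ true × member l u ≡ false
outside-list U {l} l-unique l⊆U l<U with count>0⇒witness _ room
  where
  room : 1 ≤ count (λ y → U y ∧ not (member l y))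
  room = +-cancelˡ-≤ (length l) 1 _ (begin
    length l + 1                                        ≡⟨ +-comm (length l) 1 ⟩
    suc (length l)                                      ≤⟨ l<U ⟩
    count U                                             ≡⟨ count-without U l-unique l⊆U ⟩
    length l + count (λ y → U y ∧ not (member l y))     ∎)
    where open ≤-Reasoning
... | u , u∈U∖l = u , proj₁ (∧-true⁻ u∈U∖l) , not-injective (proj₂ (∧-true⁻ u∈U∖l))

-- Opaque because with-abstracting over an unfolded pick is very slow to typecheck.
opaque
  pick : ∀ {n} (U : Pred n) k → k ≤ count U →
         ∃ λ l → Unique l × All (λ a → U a ≡ true) l × length l ≡ k
  pick U zero _ = [] , [] , [] , refl
  pick U (suc k) k<U with pick U k (≤-trans (n≤1+n k) k<U)
  ... | l , l-unique , l⊆U , refl with outside-list U l-unique l⊆U k<U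
  ... | u , u∈U , u∉l = u ∷ l , member-false⇒All≢ l u∉l ∷ l-unique , u∈U ∷ l⊆U , refl

pick₂ : ∀ {n} (U : Pred n) → 2 ≤ count U → ∃ λ x → ∃ λ y → x ≢ y × U x ≡ true × U y ≡ true
pick₂ U 2≤U with pick U 2 2≤U
... | x ∷ y ∷ [] , (x≢y ∷ []) ∷ _ , x∈U ∷ y∈U ∷ [] , refl = x , y , x≢y , x∈U , y∈U

count>0 : ∀ {n} (U : Pred n) {u} → U u ≡ true → 1 ≤ count U
count>0 U {u} u∈U = begin
  1                                                ≡⟨ cong boolToℕ u∈U ⟨
  boolToℕ (U u)                                    ≤⟨ m≤m+n _ _ ⟩
  boolToℕ (U u) + count (λ y → U y ∧ not (y == u)) ≡⟨ count-remove U u ⟨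
  count U                                          ∎
  where open ≤-Reasoning

count-all : ∀ n → count {n} (λ _ → true) ≡ n
count-all zero = refl
count-all (suc n) = cong suc (count-all n)

unique₂ : ∀ {n} {a b : Fin n} → a ≢ b → Unique (a ∷ b ∷ [])
unique₂ a≢b = (a≢b ∷ []) ∷ [] ∷ []

unique₃ : ∀ {n} {a b c : Fin n} → a ≢ b → a ≢ c → b ≢ c → Unique (a ∷ b ∷ c ∷ [])
unique₃ a≢b a≢c b≢c = (a≢b ∷ a≢c ∷ []) ∷ (b≢c ∷ []) ∷ [] ∷ []

size-tabulate : ∀ {n} (P : Pred n) → ∣ tabulate P ∣ ≡ count P
size-tabulate {zero} P = refl
size-tabulate {suc n} P with P zero
... | true = cong suc (size-tabulate (λ i → P (suc i)))
... | false = size-tabulate (λ i → P (suc i))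

size≡count : ∀ {n} (S : Subset n) → ∣ S ∣ ≡ count (lookup S)
size≡count S = trans (cong ∣_∣ (sym (tabulate∘lookup S))) (size-tabulate (lookup S))

-- Stalled sets

outDeg : ∀ {n} → Graph n → Pred n → Pred n → Fin n → ℕ
outDeg G U S x = count (λ y → Adj G x y ∧ (U y ∧ not (S y)))

StalledIn : ∀ {n} → Graph n → Pred n → Pred n → Set
StalledIn G U S = ∀ x → S x ≡ true → outDeg G U S x ≢ 1

Stalled : ∀ {n} → Graph n → Pred n → Set
Stalled G = StalledIn G (λ _ → true)

closure⊆stalled : ∀ {n} (G : Graph n) {S : Subset n} {P : Pred n} →
                  (∀ v → v ∈ S → P v ≡ true) → Stalled G P → ∀ {v} → Closure G S v → P v ≡ true
closure⊆stalled G S⊆P P-stalled (init v∈S) = S⊆P _ v∈S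
closure⊆stalled G {P = P} S⊆P P-stalled {v} (force {u} u∈cl uv others∈cl) with P v in Pv
... | true = refl
... | false = ⊥-elim (P-stalled u (closure⊆stalled G S⊆P P-stalled u∈cl) only-v-outside)
  where
  only-v-outside : count (λ y → Adj G u y ∧ not (P y)) ≡ 1
  only-v-outside = trans (count-cong outside≡v) (count-at (λ _ → true) v)
    where
    outside≡v : ∀ y → (Adj G u y ∧ not (P y)) ≡ (y == v)
    outside≡v y with y ≟ v
    ... | yes refl rewrite Pv = trans (∧-identityʳ _) (T⇒≡true uv)
    ... | no y≢v with Adj G u y in uy
    ...   | false = refl
    ...   | true rewrite closure⊆stalled G S⊆P P-stalled (others∈cl y (≡true⇒T uy) y≢v) = refl

-- Invariance under isomorphism

module ℕ-Sum = MonoidSum +-0-commutativeMonoid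

count≡sum : ∀ {n} (P : Pred n) → count P ≡ ℕ-Sum.sum (λ i → boolToℕ (P i))
count≡sum {zero} P = refl
count≡sum {suc n} P = cong (boolToℕ (P zero) +_) (count≡sum (λ i → P (suc i)))

count-permute : ∀ {n m} (π : Fin n ↔ Fin m) (P : Pred m) → count (λ i → P (Inverse.to π i)) ≡ count P
count-permute π P = begin
  count (λ i → P (Inverse.to π i))             ≡⟨ count≡sum (λ i → P (Inverse.to π i)) ⟩
  ℕ-Sum.sum (λ i → boolToℕ (P (Inverse.to π i))) ≡⟨ ℕ-Sum.sum-permute (λ i → boolToℕ (P i)) π ⟨
  ℕ-Sum.sum (λ i → boolToℕ (P i))               ≡⟨ count≡sum P ⟨
  count P                                       ∎
  where open ≡-Reasoning

≅-sym : ∀ {n m} {G : Graph n} {H : Graph m} → G ≅ H → H ≅ G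
≅-sym {H = H} φ = record
  { bij = ↔-sym bij
  ; adj-pres = λ u v → sym (trans (adj-pres (from u) (from v))
                                  (cong₂ (Adj H) (strictlyInverseˡ u) (strictlyInverseˡ v)))
  }
  where
  open _≅_ φ
  open Inverse bij using (from; strictlyInverseˡ)

≅-trans : ∀ {n m k} {G : Graph n} {H : Graph m} {K : Graph k} → G ≅ H → H ≅ K → G ≅ K
≅-trans φ ψ = record
  { bij = _≅_.bij ψ ↔-∘ _≅_.bij φ
  ; adj-pres = λ u v → trans (_≅_.adj-pres φ u v) (_≅_.adj-pres ψ (to u) (to v))
  }
  where open Inverse (_≅_.bij φ) using (to)

module _ {n m} {G : Graph n} {H : Graph m} (φ : G ≅ H) where
  open _≅_ φ
  private
    to = Inverse.to bij
    from = Inverse.from bij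

  pullback : Subset m → Subset n
  pullback S = tabulate (λ i → lookup S (to i))

  size-pullback : ∀ S → ∣ pullback S ∣ ≡ ∣ S ∣
  size-pullback S = begin
    ∣ pullback S ∣                  ≡⟨ size-tabulate (λ i → lookup S (to i)) ⟩
    count (λ i → lookup S (to i))   ≡⟨ count-permute bij (lookup S) ⟩
    count (lookup S)                ≡⟨ size≡count S ⟨
    ∣ S ∣                           ∎
    where open ≡-Reasoning

  closure-pullback : ∀ S {v} → Closure G (pullback S) v → Closure H S (to v)
  closure-pullback S {v} (init v∈S) =
    init (lookup⇒[]= _ S (trans (sym (lookup∘tabulate (λ i → lookup S (to i)) v)) ([]=⇒lookup v∈S)))
  closure-pullback S (force {u} {v} u∈cl uv others∈cl) =
    force (closure-pullback S u∈cl) (subst T (adj-pres u v) uv) others∈cl′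
    where
    to∘from : ∀ w → to (from w) ≡ w
    to∘from = Inverse.strictlyInverseˡ bij
    others∈cl′ : ∀ w → Adjacent H (to u) w → w ≢ to v → Closure H S w
    others∈cl′ w uw w≢v = subst (Closure H S) (to∘from w) (closure-pullback S (others∈cl (from w)
      (subst T (sym (trans (adj-pres u (from w)) (cong (Adj H (to u)) (to∘from w)))) uw)
      (λ fw≡v → w≢v (trans (sym (to∘from w)) (cong to fw≡v)))))

  failed-pullback : ∀ S → FailedZF H S → FailedZF G (pullback S)
  failed-pullback S (v , v∉cl) =
    from v , λ cl → v∉cl (subst (Closure H S) (Inverse.strictlyInverseˡ bij v) (closure-pullback S cl))

F-invariant : ∀ {n m k} {G : Graph n} {H : Graph m} → G ≅ H → IsFailedZFNumber H k → IsFailedZFNumber G k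
F-invariant {k = k} φ ((S , S-failed , |S|≡k) , maximal) =
  (pullback φ S , failed-pullback φ S S-failed , trans (size-pullback φ S) |S|≡k) ,
  λ S′ S′-failed →
    subst (_≤ k) (size-pullback (≅-sym φ) S′) (maximal _ (failed-pullback (≅-sym φ) S′ S′-failed))

-- Graphs on at least seven vertices have a failed set of size three

module LowerBound {n} (G : Graph n) where

  deg : Pred n → Fin n → ℕ
  deg U x = count (λ y → Adj G x y ∧ U y)

  nonNbrs : Pred n → Fin n → Pred n
  nonNbrs U x y = U y ∧ (not (y == x) ∧ not (Adj G x y))

  record FailedIn (U : Pred n) (t : ℕ) : Set where
    field
      set        : Pred n
      set⊆U      : ∀ x → set x ≡ true → U x ≡ true
      missed     : Fin n
      missed∈U   : U missed ≡ true
      missed∉set : set missed ≡ false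
      large      : t ≤ count set
      stalled    : StalledIn G U set

  FailedIn-weaken : ∀ {U t t′} → t′ ≤ t → FailedIn U t → FailedIn U t′
  FailedIn-weaken t′≤t F = record
    { set = set ; set⊆U = set⊆U ; missed = missed ; missed∈U = missed∈U ; missed∉set = missed∉set
    ; large = ≤-trans t′≤t large ; stalled = stalled }
    where open FailedIn F

  deg-split : ∀ U {l} → Unique l → All (λ a → U a ≡ true) l → ∀ x →
              deg U x ≡ outDeg G U (member l) x + tally (Adj G x) l
  deg-split U {l} l-unique l⊆U x = begin
    deg U x
      ≡⟨ count-partition (λ y → Adj G x y ∧ U y) (member l) ⟩
    count (λ y → (Adj G x y ∧ U y) ∧ member l y) + count (λ y → (Adj G x y ∧ U y) ∧ not (member l y))
      ≡⟨ cong₂ _+_ (count-cong inside) (count-cong (λ y → ∧-assoc (Adj G x y) (U y) _)) ⟩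
    count (λ y → Adj G x y ∧ member l y) + outDeg G U (member l) x
      ≡⟨ cong (_+ outDeg G U (member l) x) (count-member (Adj G x) l-unique) ⟩
    tally (Adj G x) l + outDeg G U (member l) x
      ≡⟨ +-comm (tally (Adj G x) l) _ ⟩
    outDeg G U (member l) x + tally (Adj G x) l ∎
    where
    open ≡-Reasoning
    inside : ∀ y → ((Adj G x y ∧ U y) ∧ member l y) ≡ (Adj G x y ∧ member l y)
    inside y with member l y in m
    ... | false = trans (∧-zeroʳ _) (sym (∧-zeroʳ _))
    ... | true rewrite All-member l⊆U m = cong (_∧ true) (∧-identityʳ _)

  failedIn-list : ∀ U {l} → Unique l → All (λ a → U a ≡ true) l → length l < count U →
                  All (λ x → tally (Adj G x) l + 2 ≤ deg U x) l → FailedIn U (length l)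
  failedIn-list U {l} l-unique l⊆U l<U roomy with outside-list U l-unique l⊆U l<U
  ... | u , u∈U , u∉l = record
    { set = member l
    ; set⊆U = λ x → All-member l⊆U
    ; missed = u
    ; missed∈U = u∈U
    ; missed∉set = u∉l
    ; large = ≤-reflexive (sym (count-list l-unique))
    ; stalled = stalled
    }
    where
    stalled : StalledIn G U (member l)
    stalled x x∈l out≡1 = 1+n≰n (≤-pred (begin
      suc (suc (tally (Adj G x) l)) ≡⟨ +-comm 2 _ ⟩
      tally (Adj G x) l + 2         ≤⟨ All-member roomy x∈l ⟩
      deg U x                       ≡⟨ deg-split U l-unique l⊆U x ⟩
      outDeg G U (member l) x + tally (Adj G x) l ≡⟨ cong (_+ tally (Adj G x) l) out≡1 ⟩
      suc (tally (Adj G x) l)       ∎))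
      where open ≤-Reasoning

  failedIn-dense : ∀ U k → (∀ v → U v ≡ true → suc k ≤ deg U v) → suc k ≤ count U → FailedIn U k
  failedIn-dense U k high-deg k<U with pick U k (≤-trans (n≤1+n k) k<U)
  ... | l , l-unique , l⊆U , refl = failedIn-list U l-unique l⊆U k<U (member-All l roomy)
    where
    roomy : ∀ x → member l x ≡ true → tally (Adj G x) l + 2 ≤ deg U x
    roomy x x∈l = begin
      tally (Adj G x) l + 2      ≡⟨ +-comm (tally (Adj G x) l) 2 ⟩
      suc (suc (tally (Adj G x) l)) ≤⟨ s≤s (tally<length (Adj G x) l x∈l (irrefl G x)) ⟩
      suc (length l)             ≤⟨ high-deg x (All-member l⊆U x∈l) ⟩
      deg U x                    ∎
      where open ≤-Reasoning

  count≡deg+nonNbrs : ∀ U {a} → U a ≡ true → count U ≡ suc (deg U a + count (nonNbrs U a))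
  count≡deg+nonNbrs U {a} a∈U = begin
    count U
      ≡⟨ count-remove U a ⟩
    boolToℕ (U a) + count U∖a
      ≡⟨ cong₂ _+_ (cong boolToℕ a∈U) (count-partition U∖a (Adj G a)) ⟩
    1 + (count (λ y → U∖a y ∧ Adj G a y) + count (λ y → U∖a y ∧ not (Adj G a y)))
      ≡⟨ cong suc (cong₂ _+_ (count-cong nbr) (count-cong (λ y → ∧-assoc (U y) _ _))) ⟩
    suc (deg U a + count (nonNbrs U a)) ∎
    where
    open ≡-Reasoning
    U∖a : Pred n
    U∖a y = U y ∧ not (y == a)
    nbr : ∀ y → (U∖a y ∧ Adj G a y) ≡ (Adj G a y ∧ U y)
    nbr y with y ≟ a
    ... | yes refl rewrite irrefl G y = ∧-zeroʳ _
    ... | no _ = trans (cong (_∧ Adj G a y) (∧-identityʳ (U y))) (∧-comm (U y) _)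

  nonNbr⁻ : ∀ {U x y} → nonNbrs U x y ≡ true → U y ≡ true × y ≢ x × Adj G x y ≡ false
  nonNbr⁻ {U} {x} {y} e with U y | y ≟ x | Adj G x y
  nonNbr⁻ refl | true | no y≢x | false = refl , y≢x , refl

  deg-mono : ∀ {U V} → (∀ y → V y ≡ true → U y ≡ true) → ∀ x → deg V x ≤ deg U x
  deg-mono V⊆U x = count-mono _ _ λ y e → let Axy , Vy = ∧-true⁻ e in ∧-true⁺ Axy (V⊆U y Vy)

  nonadjacent-or-complete : ∀ U →
    (∃ λ x → ∃ λ y → U x ≡ true × nonNbrs U x y ≡ true) ⊎ (∀ x → U x ≡ true → count U ≡ suc (deg U x))
  nonadjacent-or-complete U with any? (λ x → (U x Bool.≟ true) ×-dec (1 ≤? count (nonNbrs U x)))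
  ... | yes (x , x∈U , has-nonNbr) with count>0⇒witness (nonNbrs U x) has-nonNbr
  ...   | y , y∉N[x] = inj₁ (x , y , x∈U , y∉N[x])
  nonadjacent-or-complete U | no none = inj₂ complete
    where
    complete : ∀ x → U x ≡ true → count U ≡ suc (deg U x)
    complete x x∈U with count (nonNbrs U x) in c | count≡deg+nonNbrs U x∈U
    ... | zero | eq = trans eq (cong suc (+-identityʳ _))
    ... | suc _ | _ = ⊥-elim (none (x , x∈U , subst (1 ≤_) (sym c) (s≤s z≤n)))

  failedIn₁ : ∀ U → (∀ v → U v ≡ true → 2 ≤ deg U v) → 2 ≤ count U → FailedIn U 1
  failedIn₁ U = failedIn-dense U 1

  failedIn₂ : ∀ U → (∀ v → U v ≡ true → 2 ≤ deg U v) → 5 ≤ count U → FailedIn U 2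
  failedIn₂ U deg≥2 5≤U with nonadjacent-or-complete U
  ... | inj₁ (x , y , x∈U , y∉N[x]) with nonNbr⁻ {U} {x} {y} y∉N[x]
  ...   | y∈U , y≢x , x≁y =
    failedIn-list U (unique₂ (y≢x ∘ sym)) (x∈U ∷ y∈U ∷ []) (≤-trans (s≤s (s≤s (s≤s z≤n))) 5≤U) roomy
    where
    roomy : All (λ z → tally (Adj G z) (x ∷ y ∷ []) + 2 ≤ deg U z) (x ∷ y ∷ [])
    roomy = x-room ∷ y-room ∷ []
      where
      x-room : tally (Adj G x) (x ∷ y ∷ []) + 2 ≤ deg U x
      x-room rewrite irrefl G x | x≁y = deg≥2 x x∈U
      y-room : tally (Adj G y) (x ∷ y ∷ []) + 2 ≤ deg U y
      y-room rewrite Graph.sym G y x | x≁y | irrefl G y = deg≥2 y y∈U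
  failedIn₂ U deg≥2 5≤U | inj₂ complete =
    failedIn-dense U 2 (λ v v∈U → ≤-trans (s≤s (s≤s (s≤s z≤n))) (≤-pred (subst (5 ≤_) (complete v v∈U) 5≤U)))
                       (≤-trans (s≤s (s≤s (s≤s z≤n))) 5≤U)

  room-either : ∀ b {d} → 3 ≤ d → boolToℕ b + 2 ≤ d
  room-either true 3≤d = 3≤d
  room-either false 3≤d = ≤-trans (n≤1+n 2) 3≤d

  room-if-false : ∀ {b d} → b ≡ false → 2 ≤ d → boolToℕ b + 2 ≤ d
  room-if-false refl 2≤d = 2≤d

  failedIn₃-nonNbrs : ∀ U → 3 < count U → ∀ {a x y} → U a ≡ true → 2 ≤ deg U a →
                      nonNbrs U a x ≡ true → nonNbrs U a y ≡ true → x ≢ y →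
                      boolToℕ (Adj G x y) + 2 ≤ deg U x → boolToℕ (Adj G x y) + 2 ≤ deg U y →
                      FailedIn U 3
  failedIn₃-nonNbrs U 3<U {a} {x} {y} a∈U deg-a x∈N̄ y∈N̄ x≢y room-x room-y
    with nonNbr⁻ {U} {a} {x} x∈N̄ | nonNbr⁻ {U} {a} {y} y∈N̄
  ... | x∈U , x≢a , a≁x | y∈U , y≢a , a≁y =
    failedIn-list U (unique₃ (x≢a ∘ sym) (y≢a ∘ sym) x≢y) (a∈U ∷ x∈U ∷ y∈U ∷ []) 3<U
                  (a-room ∷ x-room ∷ y-room ∷ [])
    where
    a-room : tally (Adj G a) (a ∷ x ∷ y ∷ []) + 2 ≤ deg U a
    a-room rewrite irrefl G a | a≁x | a≁y = deg-a
    x-room : tally (Adj G x) (a ∷ x ∷ y ∷ []) + 2 ≤ deg U x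
    x-room rewrite Graph.sym G x a | a≁x | irrefl G x | +-identityʳ (boolToℕ (Adj G x y)) = room-x
    y-room : tally (Adj G y) (a ∷ x ∷ y ∷ []) + 2 ≤ deg U y
    y-room rewrite Graph.sym G y a | a≁y | irrefl G y | +-identityʳ (boolToℕ (Adj G y x)) | Graph.sym G y x
      = room-y

  failedIn₃-clique : ∀ U → 3 < count U → ∀ {a} → U a ≡ true → 2 ≤ deg U a → 4 ≤ count (nonNbrs U a) →
                     (∀ z → nonNbrs U a z ≡ true → count (nonNbrs U a) ≡ suc (deg (nonNbrs U a) z)) →
                     FailedIn U 3
  failedIn₃-clique U 3<U {a} a∈U deg-a 4≤N̄ clique with pick₂ (nonNbrs U a) (≤-trans (s≤s (s≤s z≤n)) 4≤N̄)
  ... | x , y , x≢y , x∈N̄ , y∈N̄ =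
    failedIn₃-nonNbrs U 3<U {a} {x} {y} a∈U deg-a x∈N̄ y∈N̄ x≢y
      (room-either (Adj G x y) (deg≥3 x x∈N̄)) (room-either (Adj G x y) (deg≥3 y y∈N̄))
    where
    deg≥3 : ∀ z → nonNbrs U a z ≡ true → 3 ≤ deg U z
    deg≥3 z z∈N̄ = ≤-trans (≤-pred (subst (4 ≤_) (clique z z∈N̄) 4≤N̄))
                          (deg-mono (λ y y∈N̄ → proj₁ (nonNbr⁻ {U} {a} {y} y∈N̄)) z)

  failedIn₃-deg2 : ∀ U → (∀ v → U v ≡ true → 2 ≤ deg U v) → 7 ≤ count U →
                   ∀ {a} → U a ≡ true → deg U a ≡ 2 → FailedIn U 3
  failedIn₃-deg2 U deg≥2 7≤U {a} a∈U deg-a≡2 with nonadjacent-or-complete (nonNbrs U a)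
  ... | inj₁ (x , y , x∈N̄ , y∉N̄[x]) with nonNbr⁻ {nonNbrs U a} {x} {y} y∉N̄[x]
  ...   | y∈N̄ , y≢x , x≁y =
    failedIn₃-nonNbrs U (≤-trans (≤ᵇ⇒≤ 4 7 _) 7≤U) {a} {x} {y} a∈U (deg≥2 a a∈U) x∈N̄ y∈N̄ (y≢x ∘ sym)
      (room-if-false x≁y (deg≥2 x (proj₁ (nonNbr⁻ {U} {a} {x} x∈N̄))))
      (room-if-false x≁y (deg≥2 y (proj₁ (nonNbr⁻ {U} {a} {y} y∈N̄))))
  failedIn₃-deg2 U deg≥2 7≤U {a} a∈U deg-a≡2 | inj₂ clique =
    failedIn₃-clique U (≤-trans (≤ᵇ⇒≤ 4 7 _) 7≤U) {a} a∈U (deg≥2 a a∈U) 4≤N̄ clique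
    where
    4≤N̄ : 4 ≤ count (nonNbrs U a)
    4≤N̄ = ≤-pred (≤-pred (≤-pred (begin
      7                                    ≤⟨ 7≤U ⟩
      count U                              ≡⟨ count≡deg+nonNbrs U a∈U ⟩
      suc (deg U a + count (nonNbrs U a))  ≡⟨ cong (λ d → suc (d + count (nonNbrs U a))) deg-a≡2 ⟩
      suc (2 + count (nonNbrs U a))        ∎)))
      where open ≤-Reasoning

  failedIn₃-deg3 : ∀ U → (∀ v → U v ≡ true → 3 ≤ deg U v) → 7 ≤ count U → FailedIn U 3
  failedIn₃-deg3 U deg≥3 7≤U with any? (λ v → (U v Bool.≟ true) ×-dec (2 ≤? count (nonNbrs U v)))
  ... | yes (v , v∈U , 2≤N̄) with pick₂ (nonNbrs U v) 2≤N̄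
  ...   | x , y , x≢y , x∈N̄ , y∈N̄ =
    failedIn₃-nonNbrs U (≤-trans (≤ᵇ⇒≤ 4 7 _) 7≤U) {v} {x} {y} v∈U (≤-trans (n≤1+n 2) (deg≥3 v v∈U))
      x∈N̄ y∈N̄ x≢y
      (room-either (Adj G x y) (deg≥3 x (proj₁ (nonNbr⁻ {U} {v} {x} x∈N̄))))
      (room-either (Adj G x y) (deg≥3 y (proj₁ (nonNbr⁻ {U} {v} {y} y∈N̄))))
  failedIn₃-deg3 U deg≥3 7≤U | no none =
    failedIn-dense U 3 deg≥4 (≤-trans (≤ᵇ⇒≤ 4 7 _) 7≤U)
    where
    deg≥4 : ∀ v → U v ≡ true → 4 ≤ deg U v
    deg≥4 v v∈U = ≤-trans (n≤1+n 4) (+-cancelʳ-≤ 1 5 (deg U v) (begin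
      6                                  ≤⟨ ≤-pred (subst (7 ≤_) (count≡deg+nonNbrs U v∈U) 7≤U) ⟩
      deg U v + count (nonNbrs U v)      ≤⟨ +-monoʳ-≤ (deg U v) (≤-pred (≰⇒> λ 2≤N̄ → none (v , v∈U , 2≤N̄))) ⟩
      deg U v + 1                        ∎))
      where open ≤-Reasoning

  failedIn₃ : ∀ U → (∀ v → U v ≡ true → 2 ≤ deg U v) → 7 ≤ count U → FailedIn U 3
  failedIn₃ U deg≥2 7≤U with any? (λ a → (U a Bool.≟ true) ×-dec (deg U a ≟ℕ 2))
  ... | yes (a , a∈U , deg-a≡2) = failedIn₃-deg2 U deg≥2 7≤U a∈U deg-a≡2
  ... | no none = failedIn₃-deg3 U (λ v v∈U → ≤∧≢⇒< (deg≥2 v v∈U) (λ 2≡deg → none (v , v∈U , sym 2≡deg))) 7≤U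

  ∧-not-∨ : ∀ u s m → (u ∧ not (s ∨ m)) ≡ ((u ∧ not m) ∧ not s)
  ∧-not-∨ false s m = refl
  ∧-not-∨ true true m = sym (∧-zeroʳ (not m))
  ∧-not-∨ true false m = sym (∧-identityʳ (not m))

  -- A failed set S′ of G[U ∖ {ℓ, p}] extends to S′ ∪ {ℓ, p}, or, when p has exactly one
  -- neighbour in U′ ∖ S′, to S′ ∪ {p}: then p also sees ℓ outside.
  module Leaf (U : Pred n) {ℓ p : Fin n} (ℓ∈U : U ℓ ≡ true) (p∈U : U p ≡ true) (ℓ~p : Adj G ℓ p ≡ true)
              (only-p : ∀ y → (Adj G ℓ y ∧ U y) ≡ true → y ≡ p) where

    ℓ≢p : ℓ ≢ p
    ℓ≢p refl with () ← trans (sym (irrefl G ℓ)) ℓ~p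

    U′ : Pred n
    U′ y = U y ∧ not (member (ℓ ∷ p ∷ []) y)

    count-U : count U ≡ 2 + count U′
    count-U = count-without U (unique₂ ℓ≢p) (ℓ∈U ∷ p∈U ∷ [])

    U′⁻ : ∀ {y} → U′ y ≡ true → U y ≡ true × y ≢ ℓ × y ≢ p
    U′⁻ {y} y∈U′ with ∧-true⁻ {U y} y∈U′
    ... | y∈U , y∉ℓp with member-false⇒All≢ (ℓ ∷ p ∷ []) (not-injective y∉ℓp)
    ...   | y≢ℓ ∷ y≢p ∷ [] = y∈U , y≢ℓ , y≢p

    U′≁ℓ : ∀ {x} → U′ x ≡ true → Adj G x ℓ ≡ false
    U′≁ℓ {x} x∈U′ with Adj G x ℓ in x~ℓ
    ... | false = refl
    ... | true with U′⁻ x∈U′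
    ...   | x∈U , _ , x≢p = ⊥-elim (x≢p (only-p x (∧-true⁺ (trans (Graph.sym G ℓ x) x~ℓ) x∈U)))

    outDeg-ℓp : ∀ S′ x → outDeg G U (λ y → S′ y ∨ member (ℓ ∷ p ∷ []) y) x ≡ outDeg G U′ S′ x
    outDeg-ℓp S′ x = count-cong λ y → cong (Adj G x y ∧_) (∧-not-∨ (U y) (S′ y) _)

    outDeg-ℓ≡0 : ∀ S′ → outDeg G U′ S′ ℓ ≡ 0
    outDeg-ℓ≡0 S′ = count-none none
      where
      none : ∀ y → (Adj G ℓ y ∧ (U′ y ∧ not (S′ y))) ≡ false
      none y with Adj G ℓ y in ℓ~y | U′ y in y∈U′
      ... | false | _ = refl
      ... | true | false = refl
      ... | true | true with () ← trans (sym (U′≁ℓ y∈U′)) (trans (Graph.sym G y ℓ) ℓ~y)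

    outDeg-p : ∀ S′ → (∀ y → S′ y ≡ true → U′ y ≡ true) → ∀ x →
               outDeg G U (λ y → S′ y ∨ member (p ∷ []) y) x ≡ boolToℕ (Adj G x ℓ) + outDeg G U′ S′ x
    outDeg-p S′ S′⊆U′ x = trans (count-remove _ ℓ) (cong₂ _+_ (cong boolToℕ at-ℓ) (count-cong elsewhere))
      where
      ℓ∉S′ : S′ ℓ ≡ false
      ℓ∉S′ with S′ ℓ in e
      ... | false = refl
      ... | true = ⊥-elim (proj₁ (proj₂ (U′⁻ (S′⊆U′ ℓ e))) refl)
      at-ℓ : (Adj G x ℓ ∧ (U ℓ ∧ not (S′ ℓ ∨ member (p ∷ []) ℓ))) ≡ Adj G x ℓ
      at-ℓ rewrite ℓ∈U | ℓ∉S′ | ==-false ℓ≢p = ∧-identityʳ _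
      elsewhere : ∀ y → ((Adj G x y ∧ (U y ∧ not (S′ y ∨ member (p ∷ []) y))) ∧ not (y == ℓ))
                        ≡ (Adj G x y ∧ (U′ y ∧ not (S′ y)))
      elsewhere y with y ≟ ℓ
      ... | yes refl = trans (∧-zeroʳ _)
                             (sym (trans (cong (λ b → Adj G x y ∧ (b ∧ not (S′ y))) (∧-zeroʳ (U y))) (∧-zeroʳ _)))
      ... | no _ = trans (∧-identityʳ _) (cong (Adj G x y ∧_) (∧-not-∨ (U y) (S′ y) _))

    module _ {t} (F′ : FailedIn U′ t) where
      open FailedIn F′ renaming (set to S′; set⊆U to S′⊆U′; stalled to S′-stalled)

      extend : ∀ ks → All (λ k → k ≡ ℓ ⊎ k ≡ p) ks → member ks p ≡ true →
               StalledIn G U (λ y → S′ y ∨ member ks y) → FailedIn U (suc t)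
      extend ks ks⊆ℓp p∈ks stalled = record
        { set = S
        ; set⊆U = S⊆U
        ; missed = missed
        ; missed∈U = proj₁ (U′⁻ missed∈U)
        ; missed∉set = trans (cong (_∨ member ks missed) missed∉set)
                             (All≢⇒member-false (All.map missed≢ks ks⊆ℓp))
        ; large = large′
        ; stalled = stalled
        }
        where
        S : Pred n
        S y = S′ y ∨ member ks y
        S⊆U : ∀ y → S y ≡ true → U y ≡ true
        S⊆U y y∈S with ∨-true⁻ {S′ y} y∈S
        ... | inj₁ y∈S′ = proj₁ (U′⁻ (S′⊆U′ y y∈S′))
        ... | inj₂ y∈ks with All-member ks⊆ℓp y∈ks
        ...   | inj₁ refl = ℓ∈U
        ...   | inj₂ refl = p∈U
        missed≢ks : ∀ {k} → k ≡ ℓ ⊎ k ≡ p → missed ≢ k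
        missed≢ks (inj₁ refl) = proj₁ (proj₂ (U′⁻ missed∈U))
        missed≢ks (inj₂ refl) = proj₂ (proj₂ (U′⁻ missed∈U))
        large′ : suc t ≤ count S
        large′ = begin
          suc t                         ≤⟨ s≤s (≤-trans large (count-mono S′ S∖p S′⊆S∖p)) ⟩
          suc (count S∖p)               ≡⟨ cong (λ b → boolToℕ b + count S∖p) (∨-introʳ p∈ks) ⟨
          boolToℕ (S p) + count S∖p     ≡⟨ count-remove S p ⟨
          count S                       ∎
          where
          open ≤-Reasoning
          S∖p : Pred n
          S∖p y = S y ∧ not (y == p)
          S′⊆S∖p : ∀ y → S′ y ≡ true → S∖p y ≡ true
          S′⊆S∖p y y∈S′ = ∧-true⁺ (∨-introˡ y∈S′) (cong not (==-false (proj₂ (proj₂ (U′⁻ (S′⊆U′ y y∈S′))))))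

      failedIn-leaf : FailedIn U (suc t)
      failedIn-leaf with outDeg G U′ S′ p ≟ℕ 1
      ... | no out-p≢1 =
        extend (ℓ ∷ p ∷ []) (inj₁ refl ∷ inj₂ refl ∷ []) (∨-introʳ {p == ℓ} (∨-introˡ (==-refl p))) stalled
        where
        stalled : StalledIn G U (λ y → S′ y ∨ member (ℓ ∷ p ∷ []) y)
        stalled x x∈S out≡1 with trans (sym (outDeg-ℓp S′ x)) out≡1 | ∨-true⁻ {S′ x} x∈S
        ... | out′≡1 | inj₁ x∈S′ = S′-stalled x x∈S′ out′≡1
        ... | out′≡1 | inj₂ x∈ℓp with member⇒∈ {x = x} (ℓ ∷ p ∷ []) x∈ℓp
        ...   | here refl with () ← trans (sym (outDeg-ℓ≡0 S′)) out′≡1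
        ...   | there (here refl) = out-p≢1 out′≡1
      ... | yes out-p≡1 = extend (p ∷ []) (inj₂ refl ∷ []) (∨-introˡ (==-refl p)) stalled
        where
        stalled : StalledIn G U (λ y → S′ y ∨ member (p ∷ []) y)
        stalled x x∈S out≡1 with trans (sym (outDeg-p S′ S′⊆U′ x)) out≡1 | ∨-true⁻ {S′ x} x∈S
        ... | out′≡1 | inj₁ x∈S′ rewrite U′≁ℓ (S′⊆U′ x x∈S′) = S′-stalled x x∈S′ out′≡1
        ... | out′≡1 | inj₂ x∈p with member⇒∈ {x = x} (p ∷ []) x∈p
        ...   | here refl rewrite Graph.sym G x ℓ | ℓ~p | out-p≡1 with () ← out′≡1

  -- min 3 ⌊(m − 1)/2⌋: a leaf and its neighbour cost two vertices and gain one, an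
  -- isolated vertex costs one.
  threshold : ℕ → ℕ
  threshold 0 = 0
  threshold 1 = 0
  threshold 2 = 0
  threshold 3 = 1
  threshold 4 = 1
  threshold 5 = 2
  threshold 6 = 2
  threshold (suc (suc (suc (suc (suc (suc (suc _))))))) = 3

  threshold-pred : ∀ m → threshold (suc m) ≤ m
  threshold-pred 0 = z≤n
  threshold-pred 1 = z≤n
  threshold-pred 2 = s≤s z≤n
  threshold-pred 3 = s≤s z≤n
  threshold-pred 4 = s≤s (s≤s z≤n)
  threshold-pred 5 = s≤s (s≤s z≤n)
  threshold-pred (suc (suc (suc (suc (suc (suc m)))))) = s≤s (s≤s (s≤s z≤n))

  threshold-step : ∀ m → threshold (suc (suc m)) ≤ suc (threshold m)
  threshold-step 0 = z≤n
  threshold-step 1 = s≤s z≤n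
  threshold-step 2 = s≤s z≤n
  threshold-step 3 = s≤s (s≤s z≤n)
  threshold-step 4 = s≤s (s≤s z≤n)
  threshold-step 5 = s≤s (s≤s (s≤s z≤n))
  threshold-step 6 = s≤s (s≤s (s≤s z≤n))
  threshold-step (suc (suc (suc (suc (suc (suc (suc m))))))) = s≤s (s≤s (s≤s z≤n))

  failedIn₀ : ∀ U {u} → U u ≡ true → FailedIn U 0
  failedIn₀ U u∈U = failedIn-list U {[]} [] [] (count>0 U u∈U) []

  failedIn-minDeg2 : ∀ U {u} → U u ≡ true → (∀ v → U v ≡ true → 2 ≤ deg U v) →
                     FailedIn U (threshold (count U))
  failedIn-minDeg2 U u∈U deg≥2 with count U in c
  ... | 0 = failedIn₀ U u∈U
  ... | 1 = failedIn₀ U u∈U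
  ... | 2 = failedIn₀ U u∈U
  ... | 3 = failedIn₁ U deg≥2 (subst (2 ≤_) (sym c) (s≤s (s≤s z≤n)))
  ... | 4 = failedIn₁ U deg≥2 (subst (2 ≤_) (sym c) (s≤s (s≤s z≤n)))
  ... | 5 = failedIn₂ U deg≥2 (subst (5 ≤_) (sym c) ≤-refl)
  ... | 6 = failedIn₂ U deg≥2 (subst (5 ≤_) (sym c) (n≤1+n 5))
  ... | suc (suc (suc (suc (suc (suc (suc m)))))) =
    failedIn₃ U deg≥2 (subst (7 ≤_) (sym c) (s≤s (s≤s (s≤s (s≤s (s≤s (s≤s (s≤s z≤n))))))))

  failedIn-isolated : ∀ U {v} → U v ≡ true → deg U v ≡ 0 → FailedIn U (threshold (count U))
  failedIn-isolated U {v} v∈U deg-v≡0 = record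
    { set = U∖v
    ; set⊆U = λ y y∈U∖v → proj₁ (∧-true⁻ {U y} y∈U∖v)
    ; missed = v
    ; missed∈U = v∈U
    ; missed∉set = trans (cong (λ b → U v ∧ not b) (==-refl v)) (∧-zeroʳ (U v))
    ; large = subst (λ m → threshold m ≤ count U∖v) (sym count-U) (threshold-pred (count U∖v))
    ; stalled = λ x x∈U∖v out≡1 → 0≢1+n (trans (sym (count-none (no-outside x x∈U∖v))) out≡1)
    }
    where
    U∖v : Pred n
    U∖v y = U y ∧ not (y == v)
    count-U : count U ≡ suc (count U∖v)
    count-U = trans (count-remove U v) (cong (λ b → boolToℕ b + count U∖v) v∈U)
    v≁ : ∀ x → U x ≡ true → Adj G v x ≡ false
    v≁ x x∈U = trans (sym (∧-identityʳ (Adj G v x)))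
                     (subst (λ b → (Adj G v x ∧ b) ≡ false) x∈U (count≡0⇒none _ deg-v≡0 x))
    no-outside : ∀ x → U∖v x ≡ true → ∀ y → (Adj G x y ∧ (U y ∧ not (U∖v y))) ≡ false
    no-outside x x∈U∖v y with y ≟ v
    ... | yes refl rewrite Graph.sym G x y | v≁ x (proj₁ (∧-true⁻ {U x} x∈U∖v)) = refl
    ... | no _ with U y
    ...   | true = ∧-zeroʳ _
    ...   | false = ∧-zeroʳ _

  failedIn-threshold : ∀ k U → count U ≤ k → 1 ≤ count U → FailedIn U (threshold (count U))
  failedIn-threshold zero U U≤0 U>0 with () ← ≤-trans U>0 U≤0
  failedIn-threshold (suc k) U U≤k U>0 with any? (λ v → (U v Bool.≟ true) ×-dec (deg U v ≟ℕ 0))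
  ... | yes (v , v∈U , isolated) = failedIn-isolated U v∈U isolated
  ... | no no-isolated with any? (λ v → (U v Bool.≟ true) ×-dec (deg U v ≟ℕ 1))
  ...   | no no-leaf = failedIn-minDeg2 U (proj₂ (count>0⇒witness U U>0)) deg≥2
    where
    deg≥2 : ∀ v → U v ≡ true → 2 ≤ deg U v
    deg≥2 v v∈U with deg U v in d
    ... | 0 = ⊥-elim (no-isolated (v , v∈U , d))
    ... | 1 = ⊥-elim (no-leaf (v , v∈U , d))
    ... | suc (suc _) = s≤s (s≤s z≤n)
  ...   | yes (ℓ , ℓ∈U , leaf) with count≡1⇒unique (λ y → Adj G ℓ y ∧ U y) leaf
  ...     | p , ℓ~p∧p∈U , only-p = subst (λ m → FailedIn U (threshold m)) (sym count-U) leaf-case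
    where
    open Leaf U ℓ∈U (proj₂ (∧-true⁻ {Adj G ℓ p} ℓ~p∧p∈U)) (proj₁ (∧-true⁻ {Adj G ℓ p} ℓ~p∧p∈U)) only-p
    leaf-case : FailedIn U (threshold (2 + count U′))
    leaf-case with count U′ in c
    ... | zero = failedIn₀ U ℓ∈U
    ... | suc m = FailedIn-weaken (threshold-step (suc m))
                    (failedIn-leaf (subst (λ m → FailedIn U′ (threshold m)) c
                      (failedIn-threshold k U′ (≤-pred (≤-trans (≤-trans (n≤1+n _) (≤-reflexive (sym count-U))) U≤k))
                                             (subst (1 ≤_) (sym c) (s≤s z≤n)))))

  threshold-≥7 : ∀ {m} → 7 ≤ m → threshold m ≡ 3
  threshold-≥7 (s≤s (s≤s (s≤s (s≤s (s≤s (s≤s (s≤s _))))))) = refl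

large-failed-set : ∀ {n} (G : Graph n) → 7 ≤ n → ∃ λ S → FailedZF G S × 3 ≤ ∣ S ∣
large-failed-set {n} G 7≤n = tabulate set , (missed , missed∉closure) , size
  where
  open LowerBound G
  open FailedIn (failedIn-threshold n (λ _ → true) (≤-reflexive (count-all n))
                                    (subst (1 ≤_) (sym (count-all n)) (≤-trans (s≤s z≤n) 7≤n)))
  missed∉closure : ¬ Closure G (tabulate set) missed
  missed∉closure cl with () ← trans (sym missed∉set)
    (closure⊆stalled G (λ v v∈S → trans (sym (lookup∘tabulate set v)) ([]=⇒lookup v∈S)) stalled cl)
  size : 3 ≤ ∣ tabulate set ∣
  size = begin
    3                          ≡⟨ threshold-≥7 7≤n ⟨
    threshold n                ≡⟨ cong threshold (count-all n) ⟨
    threshold (count {n} (λ _ → true)) ≤⟨ large ⟩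
    count set                  ≡⟨ size-tabulate set ⟨
    ∣ tabulate set ∣           ∎
    where open ≤-Reasoning

allᵇ : ∀ {n} → Pred n → Bool
allᵇ {zero} P = true
allᵇ {suc n} P = P zero ∧ allᵇ (λ i → P (suc i))

anyᵇ : ∀ {n} → Pred n → Bool
anyᵇ {zero} P = false
anyᵇ {suc n} P = P zero ∨ anyᵇ (λ i → P (suc i))

allᵇ-sound : ∀ {n} (P : Pred n) → allᵇ P ≡ true → ∀ i → P i ≡ true
allᵇ-sound P all zero = proj₁ (∧-true⁻ {P zero} all)
allᵇ-sound P all (suc i) = allᵇ-sound (λ j → P (suc j)) (proj₂ (∧-true⁻ {P zero} all)) i

anyᵇ-sound : ∀ {n} (P : Pred n) → anyᵇ P ≡ true → ∃ λ i → P i ≡ true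
anyᵇ-sound {suc n} P any with ∨-true⁻ {P zero} any
... | inj₁ P0 = zero , P0
... | inj₂ rest with anyᵇ-sound (λ j → P (suc j)) rest
...   | i , Pi = suc i , Pi

allSubsetsᵇ : ∀ n → (Subset n → Bool) → Bool
allSubsetsᵇ zero f = f []
allSubsetsᵇ (suc n) f = allSubsetsᵇ n (λ S → f (true ∷ S)) ∧ allSubsetsᵇ n (λ S → f (false ∷ S))

anySubsetᵇ : ∀ n → (Subset n → Bool) → Bool
anySubsetᵇ zero f = f []
anySubsetᵇ (suc n) f = anySubsetᵇ n (λ S → f (true ∷ S)) ∨ anySubsetᵇ n (λ S → f (false ∷ S))

allSubsetsᵇ-sound : ∀ n f → allSubsetsᵇ n f ≡ true → ∀ S → f S ≡ true
allSubsetsᵇ-sound zero f all [] = all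
allSubsetsᵇ-sound (suc n) f all (true ∷ S) = allSubsetsᵇ-sound n _ (proj₁ (∧-true⁻ {allSubsetsᵇ n _} all)) S
allSubsetsᵇ-sound (suc n) f all (false ∷ S) = allSubsetsᵇ-sound n _ (proj₂ (∧-true⁻ {allSubsetsᵇ n _} all)) S

anySubsetᵇ-sound : ∀ n f → anySubsetᵇ n f ≡ true → ∃ λ S → f S ≡ true
anySubsetᵇ-sound zero f any = [] , any
anySubsetᵇ-sound (suc n) f any with ∨-true⁻ {anySubsetᵇ n (λ S → f (true ∷ S))} any
... | inj₁ any₁ = let S , fS = anySubsetᵇ-sound n _ any₁ in true ∷ S , fS
... | inj₂ any₀ = let S , fS = anySubsetᵇ-sound n _ any₀ in false ∷ S , fS

module _ {n} (G : Graph n) where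

  stalledᵇ : Subset n → Bool
  stalledᵇ S = allᵇ λ x → not (lookup S x) ∨ not (count (λ y → Adj G x y ∧ not (lookup S y)) ≡ᵇ 1)

  stalledᵇ-sound : ∀ S → stalledᵇ S ≡ true → Stalled G (lookup S)
  stalledᵇ-sound S stalled x x∈S out≡1 with allᵇ-sound _ stalled x
  ... | holds rewrite x∈S | out≡1 with () ← holds

  someStalledᵇ : (ℕ → Bool) → Bool
  someStalledᵇ size-ok =
    anySubsetᵇ n λ S → stalledᵇ S ∧ (anyᵇ (λ v → not (lookup S v)) ∧ size-ok (count (lookup S)))

  someStalledᵇ-sound : ∀ size-ok → someStalledᵇ size-ok ≡ true →
                       ∃ λ S → FailedZF G S × size-ok ∣ S ∣ ≡ true
  someStalledᵇ-sound size-ok some with anySubsetᵇ-sound n _ some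
  ... | S , ok with ∧-true⁻ {stalledᵇ S} ok
  ...   | stalled , rest with ∧-true⁻ {anyᵇ (λ v → not (lookup S v))} rest
  ...     | proper , size with anyᵇ-sound _ proper
  ...       | v , v∉S =
    S , (v , λ cl → f≢t (trans (sym (not-injective v∉S))
                             (closure⊆stalled G (λ w w∈S → []=⇒lookup w∈S) (stalledᵇ-sound S stalled) cl)))
      , subst (λ k → size-ok k ≡ true) (sym (size≡count S)) size
    where
    f≢t : false ≢ true
    f≢t ()

  forces : Subset n → Fin n → Fin n → Bool
  forces C u v = lookup C u ∧ (Adj G u v ∧ allᵇ (λ w → not (Adj G u w) ∨ ((w == v) ∨ lookup C w)))

  forceStep : Subset n → Subset n
  forceStep C = tabulate λ v → lookup C v ∨ anyᵇ (λ u → forces C u v)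

  propagate : Subset n → ℕ → Subset n
  propagate S zero = S
  propagate S (suc k) = forceStep (propagate S k)

  propagate-sound : ∀ S k v → lookup (propagate S k) v ≡ true → Closure G S v
  propagate-sound S zero v v∈S = init (lookup⇒[]= v S v∈S)
  propagate-sound S (suc k) v v∈C′ with ∨-true⁻ {lookup C v} (trans (sym (lookup∘tabulate _ v)) v∈C′)
    where C = propagate S k
  ... | inj₁ v∈C = propagate-sound S k v v∈C
  ... | inj₂ forced with anyᵇ-sound _ forced
  ...   | u , u-forces-v with ∧-true⁻ {lookup (propagate S k) u} u-forces-v
  ...     | u∈C , rest with ∧-true⁻ {Adj G u v} rest
  ...       | u~v , others =
    force (propagate-sound S k u u∈C) (≡true⇒T u~v) others∈cl
    where
    others∈cl : ∀ w → Adjacent G u w → w ≢ v → Closure G S w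
    others∈cl w u~w w≢v with allᵇ-sound _ others w
    ... | holds rewrite T⇒≡true u~w | ==-false w≢v = propagate-sound S k w holds

  forcingᵇ : (ℕ → Bool) → Bool
  forcingᵇ size-ok = allSubsetsᵇ n λ S → not (size-ok (count (lookup S))) ∨ allᵇ (lookup (propagate S n))

  forcingᵇ-sound : ∀ size-ok → forcingᵇ size-ok ≡ true →
                   ∀ S → size-ok ∣ S ∣ ≡ true → ∀ v → Closure G S v
  forcingᵇ-sound size-ok forcing S size v with allSubsetsᵇ-sound n _ forcing S
  ... | holds rewrite sym (size≡count S) | size = propagate-sound S n v (allᵇ-sound _ holds v)

  F≡2ᵇ : Bool
  F≡2ᵇ = someStalledᵇ (_≡ᵇ 2) ∧ forcingᵇ (3 ≤ᵇ_)

  F≡2ᵇ-sound : F≡2ᵇ ≡ true → IsFailedZFNumber G 2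
  F≡2ᵇ-sound F≡2 with ∧-true⁻ {someStalledᵇ (_≡ᵇ 2)} F≡2
  ... | pair , large-force with someStalledᵇ-sound (_≡ᵇ 2) pair
  ...   | S , S-failed , |S|≡2 = (S , S-failed , ≡ᵇ⇒≡ _ 2 (≡true⇒T |S|≡2)) , at-most-2
    where
    at-most-2 : ∀ S′ → FailedZF G S′ → ∣ S′ ∣ ≤ 2
    at-most-2 S′ (v , v∉cl) with 3 ≤? ∣ S′ ∣
    ... | no |S′|≱3 = ≤-pred (≰⇒> |S′|≱3)
    ... | yes |S′|≥3 = ⊥-elim (v∉cl (forcingᵇ-sound (3 ≤ᵇ_) large-force S′ (T⇒≡true (≤⇒≤ᵇ |S′|≥3)) v))

-- Enumerating all graphs on n vertices

extend : ∀ {n} → Graph n → Subset n → Graph (suc n)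
extend {n} G N = record { Adj = adj ; sym = adj-sym ; irrefl = adj-irrefl }
  where
  adj : Fin (suc n) → Fin (suc n) → Bool
  adj zero zero = false
  adj zero (suc j) = lookup N j
  adj (suc i) zero = lookup N i
  adj (suc i) (suc j) = Adj G i j
  adj-sym : ∀ u v → adj u v ≡ adj v u
  adj-sym zero zero = refl
  adj-sym zero (suc j) = refl
  adj-sym (suc i) zero = refl
  adj-sym (suc i) (suc j) = Graph.sym G i j
  adj-irrefl : ∀ v → adj v v ≡ false
  adj-irrefl zero = refl
  adj-irrefl (suc i) = irrefl G i

empty : Graph 0
empty = record { Adj = λ () ; sym = λ () ; irrefl = λ () }

delete₀ : ∀ {n} → Graph (suc n) → Graph n
delete₀ G = record
  { Adj = λ i j → Adj G (suc i) (suc j)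
  ; sym = λ i j → Graph.sym G (suc i) (suc j)
  ; irrefl = λ i → irrefl G (suc i)
  }

-- G rebuilt vertex by vertex with extend, hence one of the graphs enumerated by allGraphsᵇ.
canon : ∀ {n} → Graph n → Graph n
canon {zero} G = empty
canon {suc n} G = extend (canon (delete₀ G)) (tabulate (Adj G zero ∘ suc))

canon-adj : ∀ {n} (G : Graph n) u v → Adj (canon G) u v ≡ Adj G u v
canon-adj {suc n} G zero zero = sym (irrefl G zero)
canon-adj {suc n} G zero (suc j) = lookup∘tabulate (Adj G zero ∘ suc) j
canon-adj {suc n} G (suc i) zero = trans (lookup∘tabulate (Adj G zero ∘ suc) i) (Graph.sym G zero (suc i))
canon-adj {suc n} G (suc i) (suc j) = canon-adj (delete₀ G) i j

canon≅ : ∀ {n} (G : Graph n) → G ≅ canon G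
canon≅ {n} G = record { bij = ↔-id (Fin n) ; adj-pres = λ u v → sym (canon-adj G u v) }

allGraphsᵇ : ∀ n → (Graph n → Bool) → Bool
allGraphsᵇ zero f = f empty
allGraphsᵇ (suc n) f = allGraphsᵇ n (λ H → allSubsetsᵇ n (λ N → f (extend H N)))

allGraphsᵇ-sound : ∀ n f → allGraphsᵇ n f ≡ true → ∀ G → f (canon G) ≡ true
allGraphsᵇ-sound zero f all G = all
allGraphsᵇ-sound (suc n) f all G =
  allSubsetsᵇ-sound n _ (allGraphsᵇ-sound n _ all (delete₀ G)) (tabulate (Adj G zero ∘ suc))

first : ∀ {n} → Pred n → Maybe (Fin n)
first {zero} P = nothing
first {suc n} P = if P zero then just zero else Maybe.map suc (first (P ∘ suc))

module IsoSearch {n} (G H : Graph n) where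

  Assignment : Set
  Assignment = List (Fin n × Fin n)

  compatible : Assignment → Fin n → Fin n → Bool
  compatible [] x c = true
  compatible ((s , t) ∷ σ) x c = not (t == c) ∧ (does (Adj G x s Bool.≟ Adj H c t) ∧ compatible σ x c)

  assign : List (Fin n) → Assignment → Maybe Assignment
  assign [] σ = just σ
  assign (x ∷ xs) σ =
    foldr (λ c rest → (if compatible σ x c then assign xs ((x , c) ∷ σ) else nothing) <∣> rest)
          nothing (allFin n)

  image : Assignment → Fin n → Fin n
  image [] x = x
  image ((s , t) ∷ σ) x = if x == s then t else image σ x

  preimage : (Fin n → Fin n) → Fin n → Fin n
  preimage f y = fromMaybe y (first (λ x → f x == y))

  verify : (Fin n → Fin n) → Maybe (G ≅ H)
  verify f with all? (λ y → f (preimage f y) ≟ y) | all? (λ x → preimage f (f x) ≟ x)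
              | all? (λ u → all? (λ v → Adj G u v Bool.≟ Adj H (f u) (f v)))
  ... | yes f∘g | yes g∘f | yes preserves =
    just (record { bij = mk↔ₛ′ f (preimage f) f∘g g∘f ; adj-pres = preserves })
  ... | _ | _ | _ = nothing

  search : Maybe (G ≅ H)
  search = assign (allFin n) [] >>= λ σ → verify (image σ)

_≅?_ : ∀ {n m} (G : Graph n) (H : Graph m) → Maybe (G ≅ H)
_≅?_ {n} {m} G H with n ≟ℕ m
... | yes refl = IsoSearch.search G H
... | no _ = nothing

Target : Set
Target = Σ ℕ Graph

-- OneOf G (_ , 3K₁) fifteen unfolds definitionally to IsOneOfFifteen G.
OneOf : ∀ {n} → Graph n → Target → List Target → Set
OneOf G (_ , T) [] = G ≅ T
OneOf G (_ , T) (T′ ∷ Ts) = G ≅ T ⊎ OneOf G T′ Ts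

recognise : ∀ {n} (G : Graph n) T Ts → Maybe (OneOf G T Ts)
recognise G (_ , T) [] = G ≅? T
recognise G (_ , T) (T′ ∷ Ts) = Maybe.map inj₁ (G ≅? T) <∣> Maybe.map inj₂ (recognise G T′ Ts)

OneOf-transport : ∀ {n m} {G : Graph n} {H : Graph m} → G ≅ H → ∀ T Ts → OneOf H T Ts → OneOf G T Ts
OneOf-transport φ (_ , T) [] ψ = ≅-trans φ ψ
OneOf-transport φ (_ , T) (T′ ∷ Ts) (inj₁ ψ) = inj₁ (≅-trans φ ψ)
OneOf-transport φ (_ , T) (T′ ∷ Ts) (inj₂ rest) = inj₂ (OneOf-transport φ T′ Ts rest)

OneOf-F≡2 : ∀ {n} {G : Graph n} T Ts → All (λ T → IsFailedZFNumber (proj₂ T) 2) (T ∷ Ts) →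
            OneOf G T Ts → IsFailedZFNumber G 2
OneOf-F≡2 (_ , T) [] (F-T ∷ []) φ = F-invariant φ F-T
OneOf-F≡2 (_ , T) (T′ ∷ Ts) (F-T ∷ _) (inj₁ φ) = F-invariant φ F-T
OneOf-F≡2 (_ , T) (T′ ∷ Ts) (_ ∷ F-Ts) (inj₂ rest) = OneOf-F≡2 T′ Ts F-Ts rest

fifteen : List Target
fifteen = (_ , K₂+K₁) ∷ (_ , K₂+K₂) ∷ (_ , K₁,₃) ∷ (_ , C₄) ∷ (_ , paw) ∷ (_ , diamond) ∷ (_ , K₄)
        ∷ (_ , P₅) ∷ (_ , C₅) ∷ (_ , bull) ∷ (_ , house) ∷ (_ , gem) ∷ (_ , P₆) ∷ (_ , net) ∷ []

All-by-check : ∀ {A : Set} {P : A → Set} (p : A → Bool) → (∀ x → p x ≡ true → P x) →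
               ∀ xs → ListAction.all p xs ≡ true → All P xs
All-by-check p sound [] _ = []
All-by-check p sound (x ∷ xs) all with ∧-true⁻ {p x} all
... | px , rest = sound x px ∷ All-by-check p sound xs rest

fifteen-F≡2 : All (λ T → IsFailedZFNumber (proj₂ T) 2) ((_ , 3K₁) ∷ fifteen)
fifteen-F≡2 = All-by-check (λ T → F≡2ᵇ (proj₂ T)) (λ T → F≡2ᵇ-sound (proj₂ T)) _ refl

3≰2 : ¬ 3 ≤ 2
3≰2 (s≤s (s≤s ()))

classifyᵇ : ∀ {n} → Graph n → Bool
classifyᵇ G = someStalledᵇ G (3 ≤ᵇ_) ∨ (forcingᵇ G (_≡ᵇ 2) ∨ is-just (recognise G (_ , 3K₁) fifteen))

classifyᵇ-sound : ∀ {n} (G : Graph n) → classifyᵇ G ≡ true → IsFailedZFNumber G 2 → IsOneOfFifteen G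
classifyᵇ-sound G classified ((S , (v , v∉cl) , |S|≡2) , maximal)
  with ∨-true⁻ {someStalledᵇ G (3 ≤ᵇ_)} classified
... | inj₁ large with someStalledᵇ-sound G (3 ≤ᵇ_) large
...   | S′ , S′-failed , |S′|≥3 = ⊥-elim (3≰2 (≤-trans (≤ᵇ⇒≤ 3 _ (≡true⇒T |S′|≥3)) (maximal S′ S′-failed)))
classifyᵇ-sound G classified ((S , (v , v∉cl) , |S|≡2) , maximal) | inj₂ rest
  with ∨-true⁻ {forcingᵇ G (_≡ᵇ 2)} rest
... | inj₁ pairs-force =
  ⊥-elim (v∉cl (forcingᵇ-sound G (_≡ᵇ 2) pairs-force S (cong (_≡ᵇ 2) |S|≡2) v))
... | inj₂ recognised with recognise G (_ , 3K₁) fifteen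
...   | just one-of = one-of

small-graphs-classified : ∀ n → n ≤ 6 → allGraphsᵇ n classifyᵇ ≡ true
small-graphs-classified 0 _ = refl
small-graphs-classified 1 _ = refl
small-graphs-classified 2 _ = refl
small-graphs-classified 3 _ = refl
small-graphs-classified 4 _ = refl
small-graphs-classified 5 _ = refl
small-graphs-classified 6 _ = refl
small-graphs-classified (suc (suc (suc (suc (suc (suc (suc _))))))) (s≤s (s≤s (s≤s (s≤s (s≤s (s≤s ()))))))

small-graphs : ∀ {n} (G : Graph n) → n ≤ 6 → IsFailedZFNumber G 2 → IsOneOfFifteen G
small-graphs {n} G n≤6 F≡2 =
  OneOf-transport (canon≅ G) (_ , 3K₁) fifteen
    (classifyᵇ-sound (canon G) (allGraphsᵇ-sound n classifyᵇ (small-graphs-classified n n≤6) G)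
                     (F-invariant (≅-sym (canon≅ G)) F≡2))

theorem2p3 : ∀ {n : ℕ} (G : Graph n) → IsFailedZFNumber G 2 ⇔ IsOneOfFifteen G
theorem2p3 {n} G = mk⇔ forward (OneOf-F≡2 (_ , 3K₁) fifteen fifteen-F≡2)
  where
  forward : IsFailedZFNumber G 2 → IsOneOfFifteen G
  forward F≡2 with n ≤? 6
  ... | yes n≤6 = small-graphs G n≤6 F≡2
  ... | no n≰6 with large-failed-set G (≰⇒> n≰6)
  ...   | S , S-failed , |S|≥3 = ⊥-elim (3≰2 (≤-trans |S|≥3 (proj₂ F≡2 S S-failed)))
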